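{- Let $n\ge 2$ and let $t_1,\dots,t_n$ be nonnegative integers with $t_1=\sum_{i=2}^n t_i$. Then $$P(t_1,t_2,\ldots,t_n)=\bigl((t_2+t_3+\cdots+t_n)!\bigr)^2=(t_1!)^2$$ and $$P'(t_1,t_2,\ldots,t_n)=\binom{t_1}{t_2,t_3,\ldots,t_n}=\frac{t_1!}{t_2!t_3!\cdots t_n!}.$$
   Context: For pairwise disjoint finite sets $T_1,\dots,T_n$ with $|T_i|=t_i$, a generalized derangement (GD) is a permutation $\sigma$ of $\bigcup T_i$ with $\sigma(a)\notin T_i$ for all $i$ and $a\in T_i$; $P(t_1,\dots,t_n)$ is their number. $P'(t_1,\dots,t_n)$ is the number of words $a_{1,1}\ldots a_{1,t_1}\ldots a_{n,1}\ldots a_{n,t_n}$ that are rearrangements of $1^{t_1}2^{t_2}\cdots n^{t_n}$ with $a_{i,j}\neq i$ for all $i,j$. -}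

module Defs where

open import Data.Nat using (ℕ; zero; suc; _*_; NonZero; _/_) renaming (_≟_ to _≟ℕ_)
open import Data.Nat using (_!)
open import Data.Nat.Properties using (_!≢0; m*n≢0)
open import Data.Fin using (Fin) renaming (_≟_ to _≟F_)
import Data.Fin.Properties as FinP
open import Data.List using (List; []; _∷_; map; concatMap; replicate; allFin; length; lookup; zip; filter)
open import Data.List.Relation.Unary.All using (All; all?)
import Data.List.Relation.Unary.Unique.DecPropositional as UniqueDec
open import Data.Product using (_×_; _,_; proj₁; proj₂)
open import Relation.Nullary using (¬_; ¬?)
open import Relation.Nullary.Decidable using (_×-dec_)
open import Relation.Binary.PropositionalEquality using (_≡_)

words : {A : Set} → List A → ℕ → List (List A)
words as zero    = [] ∷ []
words as (suc k) = concatMap (λ a → map (a ∷_) (words as k)) as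

-- Position p of this word
-- lies in block T_i iff the letter at p is i; so the ground set
-- ⋃ T_i is the set of positions Fin (length (blockWord n t)).
blockWord : (n : ℕ) → (Fin n → ℕ) → List (Fin n)
blockWord n t = concatMap (λ i → replicate (t i) i) (allFin n)

size : (n : ℕ) → (Fin n → ℕ) → ℕ
size n t = length (blockWord n t)

block : (n : ℕ) (t : Fin n → ℕ) → Fin (size n t) → Fin n
block n t = lookup (blockWord n t)

-- A permutation σ of the ground set Fin N is encoded by its list of
-- values [σ 0, …, σ (N-1)] (length N, all entries distinct).
-- It is a generalized derangement iff σ(a) ∉ T_i for a ∈ T_i, i.e. the
-- block of σ(a) differs from the block of a, for every a.
isGD : (n : ℕ) (t : Fin n → ℕ) → List (Fin (size n t)) → Set
isGD n t σ = UniqueDec.Unique _≟F_ σ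
           × All (λ p → ¬ (proj₁ p ≡ proj₂ p))
                 (zip (blockWord n t) (map (block n t) σ))

isGD? : (n : ℕ) (t : Fin n → ℕ) (σ : List (Fin (size n t))) → Relation.Nullary.Dec (isGD n t σ)
isGD? n t σ = UniqueDec.unique? _≟F_ σ
            ×-dec all? (λ p → ¬? (proj₁ p ≟F proj₂ p)) _

P : (n : ℕ) → (Fin n → ℕ) → ℕ
P n t = length (filter (isGD? n t) (words (allFin (size n t)) (size n t)))

isP'word : (n : ℕ) (t : Fin n → ℕ) → List (Fin n) → Set
isP'word n t w = All (λ i → length (filter (_≟F i) w) ≡ t i) (allFin n)
               × All (λ p → ¬ (proj₁ p ≡ proj₂ p)) (zip w (blockWord n t))

isP'word? : (n : ℕ) (t : Fin n → ℕ) (w : List (Fin n)) → Relation.Nullary.Dec (isP'word n t w)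
isP'word? n t w = all? (λ i → length (filter (_≟F i) w) ≟ℕ t i) _
                ×-dec all? (λ p → ¬? (proj₁ p ≟F proj₂ p)) _

P' : (n : ℕ) → (Fin n → ℕ) → ℕ
P' n t = length (filter (isP'word? n t) (words (allFin n) (size n t)))

prodFact : List ℕ → ℕ
prodFact []       = 1
prodFact (k ∷ ks) = k ! * prodFact ks

prodFact≢0 : (ks : List ℕ) → NonZero (prodFact ks)
prodFact≢0 []       = _
prodFact≢0 (k ∷ ks) = m*n≢0 (k !) (prodFact ks) {{k !≢0}} {{prodFact≢0 ks}}

multinomial : ℕ → List ℕ → ℕ
multinomial m ks = (m ! / prodFact ks) {{prodFact≢0 ks}}

module Submission where

-- The reference word is 0^{t₁} R with |R| = t₂ + ⋯ + tₙ = t₁.  Both counts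
-- are evaluated by reading words letter by letter against a reference word.
-- * P counts "arrangements": injective words of points whose colours
--   (blocks) differ from the reference letters.  The t₁ positions of letter
--   0 must take the t₁ points of nonzero colour (t₁! ways); R then takes the
--   t₁ points of colour 0 freely (t₁ P′ t₁ = t₁! ways)  (#arr-forced).
-- * P' counts "rearrangements" of a letter content c avoiding the reference
--   word.  Letter 0 occurs |R| times and fits only into R, so it fills R and
--   the first t₁ positions carry any word of the remaining content, whence
--   count · Π_{j≥1} c(j)! = t₁!  (#rearr-multinomial).

open import Level using (0ℓ)
open import Data.Nat using (ℕ; zero; suc; pred; _+_; _*_; _<_; _≤_; _^_; _/_; _!; NonZero; ≢-nonZero) renaming (_≟_ to _≟ℕ_)
open import Data.Nat.Properties using (+-identityʳ; +-suc; *-identityˡ; *-identityʳ; *-assoc; *-distribʳ-+; *-commutativeSemigroup; m+n≡0⇒m≡0; m+n≡0⇒n≡0; 0∸n≡0; suc-pred; suc-injective; n>0⇒n≢0; 1+n≢0)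
open import Data.Nat.Combinatorics.Base using (_P′_)
open import Data.Nat.Combinatorics.Specification using (nP′k≡n[n∸1P′k∸1]; nP′n≡n!)
open import Data.Nat.DivMod using (m*n/n≡m)
open import Data.Nat.ListAction using (sum)
open import Data.Fin using (Fin; zero; suc; _≟_)
open import Data.Fin.Properties using () renaming (suc-injective to fin-suc-injective)
open import Data.List using (List; []; _∷_; [_]; _++_; map; concatMap; replicate; tabulate; allFin; length; lookup; filter; zip)
open import Data.List.Properties using (length-++; length-replicate; map-tabulate; map-cong; tabulate-cong; filter-++; filter-all; filter-none; filter-some; filter-≐; filter-accept; filter-reject)
open import Data.List.Relation.Unary.All as All using (All; []; _∷_; all?)
open import Data.List.Relation.Unary.All.Properties using (concat⁺; map⁺; replicate⁺; tabulate⁺; tabulate⁻)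
open import Data.List.Relation.Unary.AllPairs using ([]; _∷_)
import Data.List.Relation.Unary.Unique.DecPropositional as UniqueDec
open import Data.List.Membership.Propositional using (_∈_; lose)
open import Data.List.Membership.Propositional.Properties using (∈-allFin)
open import Data.Vec.Functional using (updateAt)
open import Data.Vec.Functional.Properties using (updateAt-updates; updateAt-minimal)
open import Data.Product using (_×_; _,_; proj₁; proj₂)
open import Function using (_∘_; id)
open import Relation.Nullary using (Dec; ¬_; yes; no; ¬?; contradiction)
open import Relation.Nullary.Decidable using (_×-dec_)
open import Relation.Unary using (Pred; Decidable; _≐_)
open import Relation.Unary.Properties using (U?)
open import Relation.Binary.PropositionalEquality using (_≡_; _≢_; refl; sym; trans; cong; cong₂; ≢-sym; module ≡-Reasoning)
open import Algebra.Properties.CommutativeSemigroup *-commutativeSemigroup using (x∙yz≈y∙xz)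
open import Defs

open ≡-Reasoning

count : {A : Set} {Q : Pred A 0ℓ} → Decidable Q → List A → ℕ
count Q? xs = length (filter Q? xs)

count-≐ : {A : Set} {Q Q′ : Pred A 0ℓ} (Q? : Decidable Q) (Q′? : Decidable Q′)
  → Q ≐ Q′ → ∀ xs → count Q? xs ≡ count Q′? xs
count-≐ Q? Q′? eq xs = cong length (filter-≐ Q? Q′? eq xs)

module _ {A : Set} {Q : Pred A 0ℓ} (Q? : Decidable Q) where

  count-++ : ∀ xs ys → count Q? (xs ++ ys) ≡ count Q? xs + count Q? ys
  count-++ xs ys = trans (cong length (filter-++ Q? xs ys)) (length-++ (filter Q? xs))

  count-all : ∀ {xs} → All Q xs → count Q? xs ≡ length xs
  count-all qs = cong length (filter-all Q? qs)

  count-none : ∀ {xs} → All (¬_ ∘ Q) xs → count Q? xs ≡ 0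
  count-none ¬qs = cong length (filter-none Q? ¬qs)

  count-never : (∀ x → ¬ Q x) → ∀ xs → count Q? xs ≡ 0
  count-never ¬q xs = count-none (All.universal ¬q xs)

  count-positive : ∀ {x xs} → x ∈ xs → Q x → 0 < count Q? xs
  count-positive x∈xs qx = filter-some Q? (lose x∈xs qx)

  count-split : {Q′ : Pred A 0ℓ} (Q′? : Decidable Q′) → ∀ xs
    → count Q? xs ≡ count (λ x → Q? x ×-dec Q′? x) xs + count (λ x → Q? x ×-dec ¬? (Q′? x)) xs
  count-split Q′? [] = refl
  count-split Q′? (x ∷ xs) with Q? x | Q′? x
  ... | yes _ | yes _ = cong suc (count-split Q′? xs)
  ... | yes _ | no _  = trans (cong suc (count-split Q′? xs)) (sym (+-suc _ _))
  ... | no _  | yes _ = count-split Q′? xs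
  ... | no _  | no _  = count-split Q′? xs

count-single : {A : Set} {Q : Pred A 0ℓ} (Q? : Decidable Q) {x : A} → Q x → count Q? [ x ] ≡ 1
count-single Q? qx = count-all Q? (qx ∷ [])

count-map : {A B : Set} {Q : Pred B 0ℓ} (Q? : Decidable Q) (f : A → B)
  → ∀ xs → count Q? (map f xs) ≡ count (Q? ∘ f) xs
count-map Q? f [] = refl
count-map Q? f (x ∷ xs) with Q? (f x)
... | yes _ = cong suc (count-map Q? f xs)
... | no _  = count-map Q? f xs

count-concatMap : {A B : Set} {Q : Pred B 0ℓ} (Q? : Decidable Q) (f : A → List B)
  → ∀ xs → count Q? (concatMap f xs) ≡ sum (map (count Q? ∘ f) xs)
count-concatMap Q? f [] = refl
count-concatMap Q? f (x ∷ xs) =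
  trans (count-++ Q? (f x) (concatMap f xs)) (cong (count Q? (f x) +_) (count-concatMap Q? f xs))

sum-indicator : {A : Set} {G : Pred A 0ℓ} (G? : Decidable G) (f : A → ℕ) (K : ℕ)
  → (∀ x → G x → f x ≡ K) → (∀ x → ¬ G x → f x ≡ 0)
  → ∀ xs → sum (map f xs) ≡ count G? xs * K
sum-indicator G? f K on off [] = refl
sum-indicator G? f K on off (x ∷ xs) with G? x
... | yes g = cong₂ _+_ (on x g) (sum-indicator G? f K on off xs)
... | no ¬g = cong₂ _+_ (off x ¬g) (sum-indicator G? f K on off xs)

allFin-suc : ∀ n → allFin (suc n) ≡ zero ∷ map suc (allFin n)
allFin-suc n = cong (zero ∷_) (sym (map-tabulate id suc))

sum-allFin : ∀ {n} (f : Fin n → ℕ) → sum (map f (allFin n)) ≡ sum (tabulate f)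
sum-allFin f = cong sum (map-tabulate id f)

sum-tabulate-*ʳ : ∀ {m} (f : Fin m → ℕ) K → sum (tabulate f) * K ≡ sum (tabulate (λ i → f i * K))
sum-tabulate-*ʳ {zero}  f K = refl
sum-tabulate-*ʳ {suc m} f K = trans (*-distribʳ-+ K (f zero) _) (cong (f zero * K +_) (sum-tabulate-*ʳ (f ∘ suc) K))

sum-tabulate-≡0 : ∀ {m} (f : Fin m → ℕ) → sum (tabulate f) ≡ 0 → ∀ i → f i ≡ 0
sum-tabulate-≡0 f Σ≡0 zero    = m+n≡0⇒m≡0 (f zero) Σ≡0
sum-tabulate-≡0 f Σ≡0 (suc i) = sum-tabulate-≡0 (f ∘ suc) (m+n≡0⇒n≡0 (f zero) Σ≡0) i

count-allFin-suc : ∀ {n} {Q : Pred (Fin (suc n)) 0ℓ} (Q? : Decidable Q)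
  → count Q? (allFin (suc n)) ≡ count Q? [ zero ] + count (Q? ∘ suc) (allFin n)
count-allFin-suc {n} Q? = begin
  count Q? (allFin (suc n))                              ≡⟨ cong (count Q?) (allFin-suc n) ⟩
  count Q? ([ zero ] ++ map suc (allFin n))              ≡⟨ count-++ Q? [ zero ] (map suc (allFin n)) ⟩
  count Q? [ zero ] + count Q? (map suc (allFin n))      ≡⟨ cong (count Q? [ zero ] +_) (count-map Q? suc (allFin n)) ⟩
  count Q? [ zero ] + count (Q? ∘ suc) (allFin n)        ∎

count-allFin-≡ : ∀ {n} (x : Fin n) → count (x ≟_) (allFin n) ≡ 1
count-allFin-≡ {suc n} zero =
  trans (count-allFin-suc {n} (zero ≟_)) (cong suc (count-never (λ y → zero ≟ suc y) (λ _ ()) (allFin n)))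
count-allFin-≡ {suc n} (suc x) = begin
  count (suc x ≟_) (allFin (suc n))               ≡⟨ count-allFin-suc {n} (suc x ≟_) ⟩
  count (λ y → suc x ≟ suc y) (allFin n)          ≡⟨ count-≐ (λ y → suc x ≟ suc y) (x ≟_) (fin-suc-injective , cong suc) (allFin n) ⟩
  count (x ≟_) (allFin n)                         ≡⟨ count-allFin-≡ x ⟩
  1                                               ∎

_∖_ : ∀ {N} → Pred (Fin N) 0ℓ → Fin N → Pred (Fin N) 0ℓ
(Q ∖ x) y = Q y × x ≢ y

_∖?_ : ∀ {N} {Q : Pred (Fin N) 0ℓ} → Decidable Q → (x : Fin N) → Decidable (Q ∖ x)
(Q? ∖? x) y = Q? y ×-dec ¬? (x ≟ y)

count-remove : ∀ {N} {Q : Pred (Fin N) 0ℓ} (Q? : Decidable Q) {x : Fin N}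
  → Q x → count Q? (allFin N) ≡ suc (count (Q? ∖? x) (allFin N))
count-remove {N} Q? {x} qx =
  trans (count-split Q? (x ≟_) (allFin N)) (cong (_+ count (Q? ∖? x) (allFin N)) just-x)
  where
  just-x : count (λ y → Q? y ×-dec (x ≟ y)) (allFin N) ≡ 1
  just-x = trans (count-≐ _ (x ≟_) (proj₂ , λ { refl → qx , refl }) (allFin N)) (count-allFin-≡ x)

count-lookup : {A : Set} {Q : Pred A 0ℓ} (Q? : Decidable Q) (xs : List A)
  → count (Q? ∘ lookup xs) (allFin (length xs)) ≡ count Q? xs
count-lookup Q? [] = refl
count-lookup Q? (x ∷ xs) = begin
  count (Q? ∘ lookup (x ∷ xs)) (allFin (suc (length xs)))
    ≡⟨ count-allFin-suc (Q? ∘ lookup (x ∷ xs)) ⟩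
  count (Q? ∘ lookup (x ∷ xs)) [ zero ] + count (Q? ∘ lookup xs) (allFin (length xs))
    ≡⟨ cong₂ _+_ (sym (count-map Q? (lookup (x ∷ xs)) [ zero ])) (count-lookup Q? xs) ⟩
  count Q? [ x ] + count Q? xs
    ≡⟨ count-++ Q? [ x ] xs ⟨
  count Q? (x ∷ xs) ∎

count-words-suc : {A : Set} {Q : Pred (List A) 0ℓ} (Q? : Decidable Q) (as : List A) (m : ℕ)
  → count Q? (words as (suc m)) ≡ sum (map (λ a → count (Q? ∘ (a ∷_)) (words as m)) as)
count-words-suc Q? as m =
  trans (count-concatMap Q? (λ a → map (a ∷_) (words as m)) as)
        (cong sum (map-cong (λ a → count-map Q? (a ∷_) (words as m)) as))

P′-suc : ∀ m k → m P′ suc k ≡ m * (pred m P′ k)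
P′-suc zero    k = cong (_* (0 P′ k)) (0∸n≡0 k)
P′-suc (suc m) k = nP′k≡n[n∸1P′k∸1] (suc m) (suc k)

Disagree : {A : Set} → List A → List A → Set
Disagree xs ys = All (λ p → proj₁ p ≢ proj₂ p) (zip xs ys)

disagree? : ∀ {n} (xs ys : List (Fin n)) → Dec (Disagree xs ys)
disagree? xs ys = all? (λ p → ¬? (proj₁ p ≟ proj₂ p)) (zip xs ys)

module Arrangements {N n : ℕ} (colour : Fin N → Fin n) where

  Arrangement : Pred (Fin N) 0ℓ → List (Fin n) → Pred (List (Fin N)) 0ℓ
  Arrangement A r σ = UniqueDec.Unique _≟_ σ × All A σ × Disagree r (map colour σ)

  arrangement? : {A : Pred (Fin N) 0ℓ} → Decidable A → (r : List (Fin n)) → Decidable (Arrangement A r)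
  arrangement? A? r σ = UniqueDec.unique? _≟_ σ ×-dec all? A? σ ×-dec disagree? r (map colour σ)

  #arr : {A : Pred (Fin N) 0ℓ} → Decidable A → List (Fin n) → ℕ → ℕ
  #arr A? r m = count (arrangement? A? r) (words (allFin N) m)

  Avoids : Pred (Fin N) 0ℓ → Fin n → Pred (Fin N) 0ℓ
  Avoids A c x = A x × c ≢ colour x

  avoids? : {A : Pred (Fin N) 0ℓ} → Decidable A → (c : Fin n) → Decidable (Avoids A c)
  avoids? A? c x = A? x ×-dec ¬? (c ≟ colour x)

  OfColour : Pred (Fin N) 0ℓ → Fin n → Pred (Fin N) 0ℓ
  OfColour A c x = A x × colour x ≡ c

  ofColour? : {A : Pred (Fin N) 0ℓ} → Decidable A → (c : Fin n) → Decidable (OfColour A c)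
  ofColour? A? c x = A? x ×-dec (colour x ≟ c)

  arrangement-cons⁻ : ∀ {A r₀ r a σ} → Arrangement A (r₀ ∷ r) (a ∷ σ)
    → Avoids A r₀ a × Arrangement (A ∖ a) r σ
  arrangement-cons⁻ (a∉σ ∷ uσ , Aa ∷ Aσ , r₀≢a ∷ dσ) = (Aa , r₀≢a) , uσ , All.zip (Aσ , a∉σ) , dσ

  arrangement-cons⁺ : ∀ {A r₀ r a σ} → Avoids A r₀ a → Arrangement (A ∖ a) r σ
    → Arrangement A (r₀ ∷ r) (a ∷ σ)
  arrangement-cons⁺ (Aa , r₀≢a) (uσ , Aσ∖a , dσ) =
    let (Aσ , a∉σ) = All.unzip Aσ∖a in a∉σ ∷ uσ , Aa ∷ Aσ , r₀≢a ∷ dσ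

  #arr-cons : ∀ {A} (A? : Decidable A) r₀ r m K
    → (∀ a → Avoids A r₀ a → #arr (A? ∖? a) r m ≡ K)
    → #arr A? (r₀ ∷ r) (suc m) ≡ count (avoids? A? r₀) (allFin N) * K
  #arr-cons {A} A? r₀ r m K rest =
    trans (count-words-suc (arrangement? A? (r₀ ∷ r)) (allFin N) m)
          (sum-indicator (avoids? A? r₀) _ K placeable unplaceable (allFin N))
    where
    placeable : ∀ a → Avoids A r₀ a → count (arrangement? A? (r₀ ∷ r) ∘ (a ∷_)) (words (allFin N) m) ≡ K
    placeable a av =
      trans (count-≐ _ (arrangement? (A? ∖? a) r) (proj₂ ∘ arrangement-cons⁻ , arrangement-cons⁺ av) (words (allFin N) m))
            (rest a av)

    unplaceable : ∀ a → ¬ Avoids A r₀ a → count (arrangement? A? (r₀ ∷ r) ∘ (a ∷_)) (words (allFin N) m) ≡ 0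
    unplaceable a ¬av = count-never _ (λ σ arr → ¬av (proj₁ (arrangement-cons⁻ arr))) (words (allFin N) m)

  module _ (o : Fin n) where

    -- If no letter of r is o and all points of A have colour o, colours
    -- impose nothing: arrangements are injective words in A.
    #arr-free : ∀ r → All (_≢ o) r → ∀ {A} (A? : Decidable A) → (∀ {x} → A x → colour x ≡ o)
      → #arr A? r (length r) ≡ count A? (allFin N) P′ length r
    #arr-free [] [] A? _ = count-single (arrangement? A? []) ([] , [] , [])
    #arr-free (r₀ ∷ r) (r₀≢o ∷ r≢o) {A} A? A⇒o = begin
      #arr A? (r₀ ∷ r) (suc (length r))
        ≡⟨ #arr-cons A? r₀ r (length r) (pred #A P′ length r) rest ⟩
      count (avoids? A? r₀) (allFin N) * (pred #A P′ length r)
        ≡⟨ cong (_* (pred #A P′ length r)) all-placeable ⟩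
      #A * (pred #A P′ length r)
        ≡⟨ P′-suc #A (length r) ⟨
      #A P′ suc (length r) ∎
      where
      #A : ℕ
      #A = count A? (allFin N)

      all-placeable : count (avoids? A? r₀) (allFin N) ≡ #A
      all-placeable = count-≐ _ A? (proj₁ , λ Ax → Ax , λ r₀≡ → r₀≢o (trans r₀≡ (A⇒o Ax))) (allFin N)

      rest : ∀ a → Avoids A r₀ a → #arr (A? ∖? a) r (length r) ≡ pred #A P′ length r
      rest a (Aa , _) = trans (#arr-free r r≢o (A? ∖? a) (A⇒o ∘ proj₁))
                              (cong (λ m → pred m P′ length r) (sym (count-remove A? Aa)))

    -- Against o^a R, with R free of o and exactly a points of A not of
    -- colour o: those a points fill the o-positions in a! ways, after which
    -- R receives points of colour o freely.
    #arr-forced : ∀ R → All (_≢ o) R → ∀ a {A} (A? : Decidable A)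
      → count (avoids? A? o) (allFin N) ≡ a
      → #arr A? (replicate a o ++ R) (a + length R) ≡ a ! * (count (ofColour? A? o) (allFin N) P′ length R)
    #arr-forced R R≢o zero {A} A? none = begin
      #arr A? R (length R)                                       ≡⟨ #arr-free R R≢o A? A⇒o ⟩
      count A? (allFin N) P′ length R                            ≡⟨ cong (_P′ length R) all-of-colour ⟩
      count (ofColour? A? o) (allFin N) P′ length R              ≡⟨ *-identityˡ _ ⟨
      1 * (count (ofColour? A? o) (allFin N) P′ length R)        ∎
      where
      A⇒o : ∀ {x} → A x → colour x ≡ o
      A⇒o {x} Ax with colour x ≟ o
      ... | yes x∈o = x∈o
      ... | no  x∉o = contradiction none (n>0⇒n≢0 (count-positive (avoids? A? o) (∈-allFin x) (Ax , x∉o ∘ sym)))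

      all-of-colour : count A? (allFin N) ≡ count (ofColour? A? o) (allFin N)
      all-of-colour = count-≐ A? _ ((λ Ax → Ax , A⇒o Ax) , proj₁) (allFin N)
    #arr-forced R R≢o (suc a) {A} A? placeable = begin
      #arr A? (o ∷ replicate a o ++ R) (suc (a + length R))
        ≡⟨ #arr-cons A? o (replicate a o ++ R) (a + length R) (a ! * X) rest ⟩
      count (avoids? A? o) (allFin N) * (a ! * X)
        ≡⟨ cong (_* (a ! * X)) placeable ⟩
      suc a * (a ! * X)
        ≡⟨ *-assoc (suc a) (a !) X ⟨
      suc a ! * X ∎
      where
      X : ℕ
      X = count (ofColour? A? o) (allFin N) P′ length R

      rest : ∀ x → Avoids A o x → #arr (A? ∖? x) (replicate a o ++ R) (a + length R) ≡ a ! * X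
      rest x (Ax , o≢x) = trans (#arr-forced R R≢o a (A? ∖? x) fewer) (cong (λ m → a ! * (m P′ length R)) same)
        where
        fewer : count (avoids? (A? ∖? x) o) (allFin N) ≡ a
        fewer = suc-injective (begin
          suc (count (avoids? (A? ∖? x) o) (allFin N))
            ≡⟨ cong suc (count-≐ _ (avoids? A? o ∖? x)
                 ((λ ((Ay , x≢y) , o≢y) → (Ay , o≢y) , x≢y) , (λ ((Ay , o≢y) , x≢y) → (Ay , x≢y) , o≢y)) (allFin N)) ⟩
          suc (count (avoids? A? o ∖? x) (allFin N))
            ≡⟨ count-remove (avoids? A? o) (Ax , o≢x) ⟨
          count (avoids? A? o) (allFin N)
            ≡⟨ placeable ⟩
          suc a ∎)

        same : count (ofColour? (A? ∖? x) o) (allFin N) ≡ count (ofColour? A? o) (allFin N)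
        same = count-≐ _ _ ((λ ((Ay , _) , y∈o) → Ay , y∈o) ,
                            (λ { (Ay , y∈o) → (Ay , λ { refl → o≢x (sym y∈o) }) , y∈o })) (allFin N)

_⁻_ : ∀ {n} → (Fin n → ℕ) → Fin n → (Fin n → ℕ)
c ⁻ a = updateAt c a pred

sum-⁻ : ∀ {m} (f : Fin m → ℕ) i {u} → f i ≡ suc u → sum (tabulate f) ≡ suc (sum (tabulate (f ⁻ i)))
sum-⁻ f zero    fi rewrite fi = refl
sum-⁻ f (suc i) fi = trans (cong (f zero +_) (sum-⁻ (f ∘ suc) i fi)) (+-suc (f zero) _)

prodFact-⁻ : ∀ {m} (f : Fin m → ℕ) i {u} → f i ≡ suc u
  → prodFact (tabulate f) ≡ suc u * prodFact (tabulate (f ⁻ i))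
prodFact-⁻ f zero {u} fi rewrite fi = *-assoc (suc u) (u !) _
prodFact-⁻ f (suc i) {u} fi =
  trans (cong (f zero ! *_) (prodFact-⁻ (f ∘ suc) i fi)) (x∙yz≈y∙xz (f zero !) (suc u) _)

prodFact-zeros : ∀ {m} (f : Fin m → ℕ) → (∀ i → f i ≡ 0) → prodFact (tabulate f) ≡ 1
prodFact-zeros {zero}  f _ = refl
prodFact-zeros {suc m} f f≡0 = cong₂ _*_ (cong _! (f≡0 zero)) (prodFact-zeros (f ∘ suc) (f≡0 ∘ suc))

module _ {n : ℕ} where

  occ : Fin n → List (Fin n) → ℕ
  occ i = count (_≟ i)

  occ-here : ∀ a w → occ a (a ∷ w) ≡ suc (occ a w)
  occ-here a w = cong length (filter-accept (_≟ a) refl)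

  occ-there : ∀ {a i} w → a ≢ i → occ i (a ∷ w) ≡ occ i w
  occ-there {i = i} w a≢i = cong length (filter-reject (_≟ i) a≢i)

  HasContent : (Fin n → ℕ) → List (Fin n) → Set
  HasContent c w = All (λ i → occ i w ≡ c i) (allFin n)

  content-cons⁻ : ∀ {c a w} → HasContent c (a ∷ w) → c a ≢ 0 × HasContent (c ⁻ a) w
  content-cons⁻ {c} {a} {w} hc = ca≢0 , tabulate⁺ content
    where
    occ≡ : ∀ i → occ i (a ∷ w) ≡ c i
    occ≡ = tabulate⁻ hc

    ca≢0 : c a ≢ 0
    ca≢0 ca≡0 = 1+n≢0 (trans (sym (occ-here a w)) (trans (occ≡ a) ca≡0))

    content : ∀ i → occ i w ≡ (c ⁻ a) i
    content i with i ≟ a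
    ... | yes refl = trans (cong pred (trans (sym (occ-here a w)) (occ≡ a))) (sym (updateAt-updates a c))
    ... | no  i≢a  = trans (sym (occ-there w (≢-sym i≢a))) (trans (occ≡ i) (sym (updateAt-minimal i a c i≢a)))

  content-cons⁺ : ∀ {c a w} → c a ≢ 0 → HasContent (c ⁻ a) w → HasContent c (a ∷ w)
  content-cons⁺ {c} {a} {w} ca≢0 hc = tabulate⁺ content
    where
    occ≡ : ∀ i → occ i w ≡ (c ⁻ a) i
    occ≡ = tabulate⁻ hc

    content : ∀ i → occ i (a ∷ w) ≡ c i
    content i with i ≟ a
    ... | yes refl = trans (occ-here a w) (trans (cong suc (trans (occ≡ a) (updateAt-updates a c)))
                                                 (suc-pred (c a) {{≢-nonZero ca≢0}}))
    ... | no  i≢a  = trans (occ-there w (≢-sym i≢a)) (trans (occ≡ i) (updateAt-minimal i a c i≢a))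

  Rearrangement : (Fin n → ℕ) → List (Fin n) → Pred (List (Fin n)) 0ℓ
  Rearrangement c r w = HasContent c w × Disagree w r

  rearrangement? : (c : Fin n → ℕ) (r : List (Fin n)) → Decidable (Rearrangement c r)
  rearrangement? c r w = all? (λ i → occ i w ≟ℕ c i) (allFin n) ×-dec disagree? w r

  #rearr : (Fin n → ℕ) → List (Fin n) → ℕ → ℕ
  #rearr c r m = count (rearrangement? c r) (words (allFin n) m)

  branch : (Fin n → ℕ) → Fin n → List (Fin n) → Fin n → ℕ → ℕ
  branch c r₀ r a m = count (rearrangement? c (r₀ ∷ r) ∘ (a ∷_)) (words (allFin n) m)

  rearrangement-cons⁻ : ∀ {c r₀ r a w} → Rearrangement c (r₀ ∷ r) (a ∷ w)
    → (c a ≢ 0 × a ≢ r₀) × Rearrangement (c ⁻ a) r w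
  rearrangement-cons⁻ (hc , a≢r₀ ∷ d) = let (ca≢0 , hc′) = content-cons⁻ hc in (ca≢0 , a≢r₀) , hc′ , d

  rearrangement-cons⁺ : ∀ {c r₀ r a w} → c a ≢ 0 → a ≢ r₀ → Rearrangement (c ⁻ a) r w
    → Rearrangement c (r₀ ∷ r) (a ∷ w)
  rearrangement-cons⁺ ca≢0 a≢r₀ (hc , d) = content-cons⁺ ca≢0 hc , a≢r₀ ∷ d

  branch-live : ∀ c r₀ r a m → c a ≢ 0 → a ≢ r₀ → branch c r₀ r a m ≡ #rearr (c ⁻ a) r m
  branch-live c r₀ r a m ca≢0 a≢r₀ =
    count-≐ _ (rearrangement? (c ⁻ a) r) (proj₂ ∘ rearrangement-cons⁻ , rearrangement-cons⁺ ca≢0 a≢r₀)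
            (words (allFin n) m)

  branch-dead : ∀ c r₀ r a m → ¬ (c a ≢ 0 × a ≢ r₀) → branch c r₀ r a m ≡ 0
  branch-dead c r₀ r a m blocked =
    count-never _ (λ w rw → blocked (proj₁ (rearrangement-cons⁻ rw))) (words (allFin n) m)

#rearr-zeros : ∀ {k} r → All (_≢ zero) r → (c : Fin (suc k) → ℕ)
  → c zero ≡ length r → (∀ j → c (suc j) ≡ 0) → #rearr c r (length r) ≡ 1
#rearr-zeros [] [] c c0 cs = count-single (rearrangement? c []) {[]} (tabulate⁺ empty , [])
  where
  empty : ∀ i → occ i [] ≡ c i
  empty zero    = sym c0
  empty (suc j) = sym (cs j)
#rearr-zeros {k} (r₀ ∷ r) (r₀≢0 ∷ r≢0) c c0 cs = begin
  #rearr c (r₀ ∷ r) (suc (length r))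
    ≡⟨ count-words-suc (rearrangement? c (r₀ ∷ r)) (allFin (suc k)) (length r) ⟩
  sum (map (λ a → branch c r₀ r a (length r)) (allFin (suc k)))
    ≡⟨ sum-indicator (zero ≟_) _ 1 only-zero others (allFin (suc k)) ⟩
  count (zero ≟_) (allFin (suc k)) * 1
    ≡⟨ cong (_* 1) (count-allFin-≡ {suc k} zero) ⟩
  1 ∎
  where
  only-zero : ∀ a → zero ≡ a → branch c r₀ r a (length r) ≡ 1
  only-zero _ refl = trans (branch-live c r₀ r zero (length r) (λ c0≡0 → 1+n≢0 (trans (sym c0) c0≡0)) (≢-sym r₀≢0))
                           (#rearr-zeros r r≢0 (c ⁻ zero) (cong pred c0) cs)

  others : ∀ a → zero ≢ a → branch c r₀ r a (length r) ≡ 0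
  others zero    z≢z = contradiction refl z≢z
  others (suc j) _   = branch-dead c r₀ r (suc j) (length r) (λ (cj≢0 , _) → cj≢0 (cs j))

-- Against 0^a R with R free of zero, where zero occurs |R| times and the
-- other letters a times in total: the zeros fill R and the other letters
-- are arranged freely in the first a positions.
#rearr-multinomial : ∀ {k} (R : List (Fin (suc k))) → All (_≢ zero) R → ∀ a (c : Fin (suc k) → ℕ)
  → c zero ≡ length R → sum (tabulate (c ∘ suc)) ≡ a
  → #rearr c (replicate a zero ++ R) (a + length R) * prodFact (tabulate (c ∘ suc)) ≡ a !
#rearr-multinomial R R≢0 zero c c0 Σ≡0 =
  cong₂ _*_ (#rearr-zeros R R≢0 c c0 others-absent) (prodFact-zeros (c ∘ suc) others-absent)
  where
  others-absent : ∀ j → c (suc j) ≡ 0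
  others-absent = sum-tabulate-≡0 (c ∘ suc) Σ≡0
#rearr-multinomial {k} R R≢0 (suc a) c c0 Σ≡1+a = begin
  #rearr c (zero ∷ r) (suc m) * PF
    ≡⟨ cong (_* PF) (trans (count-words-suc (rearrangement? c (zero ∷ r)) (allFin (suc k)) m) (sum-allFin first)) ⟩
  sum (tabulate first) * PF
    ≡⟨ sum-tabulate-*ʳ first PF ⟩
  first zero * PF + sum (tabulate (λ j → first (suc j) * PF))
    ≡⟨ cong₂ _+_ (cong (_* PF) zero-dead) (cong sum (tabulate-cong weight)) ⟩
  sum (tabulate (λ j → c (suc j) * a !))
    ≡⟨ sum-tabulate-*ʳ (c ∘ suc) (a !) ⟨
  sum (tabulate (c ∘ suc)) * a !
    ≡⟨ cong (_* a !) Σ≡1+a ⟩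
  suc a * a ! ∎
  where
  r : List (Fin (suc k))
  r = replicate a zero ++ R

  m PF : ℕ
  m  = a + length R
  PF = prodFact (tabulate (c ∘ suc))

  first : Fin (suc k) → ℕ
  first x = branch c zero r x m

  zero-dead : first zero ≡ 0
  zero-dead = branch-dead c zero r zero m (λ (_ , z≢z) → z≢z refl)

  weight : ∀ j → first (suc j) * PF ≡ c (suc j) * a !
  weight j with c (suc j) in cj
  ... | zero  = cong (_* PF) (branch-dead c zero r (suc j) m (λ (cj≢0 , _) → cj≢0 cj))
  ... | suc u = begin
    first (suc j) * PF                            ≡⟨ cong₂ _*_ live (prodFact-⁻ (c ∘ suc) j cj) ⟩
    #rearr c′ r m * (suc u * PF′)                 ≡⟨ x∙yz≈y∙xz (#rearr c′ r m) (suc u) PF′ ⟩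
    suc u * (#rearr c′ r m * PF′)                 ≡⟨ cong (suc u *_) (#rearr-multinomial R R≢0 a c′ c0 Σ′≡a) ⟩
    suc u * a !                                   ∎
    where
    c′ : Fin (suc k) → ℕ
    c′ = c ⁻ suc j

    PF′ : ℕ
    PF′ = prodFact (tabulate (c′ ∘ suc))

    live : first (suc j) ≡ #rearr c′ r m
    live = branch-live c zero r (suc j) m (λ cj≡0 → 1+n≢0 (trans (sym cj) cj≡0)) (λ ())

    Σ′≡a : sum (tabulate (c′ ∘ suc)) ≡ a
    Σ′≡a = suc-injective (trans (sym (sum-⁻ (c ∘ suc) j cj)) Σ≡1+a)

blocks : ∀ {n} → (Fin n → ℕ) → List (Fin n) → List (Fin n)
blocks t = concatMap (λ i → replicate (t i) i)

length-blocks : ∀ {n} (t : Fin n → ℕ) is → length (blocks t is) ≡ sum (map t is)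
length-blocks t []       = refl
length-blocks t (i ∷ is) =
  trans (length-++ (replicate (t i) i)) (cong₂ _+_ (length-replicate (t i)) (length-blocks t is))

module BlockWord {k : ℕ} (t : Fin (suc k) → ℕ) where

  rest : List (Fin (suc k))
  rest = blocks t (tabulate suc)

  rest≢0 : All (_≢ zero) rest
  rest≢0 = concat⁺ (map⁺ (tabulate⁺ (λ j → replicate⁺ (t (suc j)) (λ ()))))

  length-rest : length rest ≡ sum (tabulate (t ∘ suc))
  length-rest = trans (length-blocks t (tabulate suc)) (cong sum (map-tabulate suc t))

  size≡ : size (suc k) t ≡ t zero + length rest
  size≡ = trans (length-++ (replicate (t zero) zero)) (cong (_+ length rest) (length-replicate (t zero)))

  open Arrangements (block (suc k) t)

  #colour-0 : count (ofColour? U? zero) (allFin (size (suc k) t)) ≡ t zero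
  #colour-0 = begin
    count (ofColour? U? zero) (allFin (size (suc k) t))
      ≡⟨ count-≐ _ ((_≟ zero) ∘ block (suc k) t) (proj₂ , (_ ,_)) (allFin (size (suc k) t)) ⟩
    count ((_≟ zero) ∘ block (suc k) t) (allFin (size (suc k) t))
      ≡⟨ count-lookup (_≟ zero) (blockWord (suc k) t) ⟩
    count (_≟ zero) (replicate (t zero) zero ++ rest)
      ≡⟨ count-++ (_≟ zero) (replicate (t zero) zero) rest ⟩
    count (_≟ zero) (replicate (t zero) zero) + count (_≟ zero) rest
      ≡⟨ cong₂ _+_ (count-all (_≟ zero) (replicate⁺ (t zero) refl)) (count-none (_≟ zero) rest≢0) ⟩
    length (replicate (t zero) zero) + 0
      ≡⟨ trans (+-identityʳ _) (length-replicate (t zero)) ⟩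
    t zero ∎

  #colour-≢0 : count (avoids? U? zero) (allFin (size (suc k) t)) ≡ length rest
  #colour-≢0 = begin
    count (avoids? U? zero) (allFin (size (suc k) t))
      ≡⟨ count-≐ _ (¬? ∘ (zero ≟_) ∘ block (suc k) t) (proj₂ , (_ ,_)) (allFin (size (suc k) t)) ⟩
    count (¬? ∘ (zero ≟_) ∘ block (suc k) t) (allFin (size (suc k) t))
      ≡⟨ count-lookup (¬? ∘ (zero ≟_)) (blockWord (suc k) t) ⟩
    count (¬? ∘ (zero ≟_)) (replicate (t zero) zero ++ rest)
      ≡⟨ count-++ (¬? ∘ (zero ≟_)) (replicate (t zero) zero) rest ⟩
    count (¬? ∘ (zero ≟_)) (replicate (t zero) zero) + count (¬? ∘ (zero ≟_)) rest
      ≡⟨ cong₂ _+_ (count-none (¬? ∘ (zero ≟_)) (replicate⁺ (t zero) (λ 0≢0 → 0≢0 refl)))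
                   (count-all (¬? ∘ (zero ≟_)) (All.map ≢-sym rest≢0)) ⟩
    length rest ∎

  P-closed : t zero ≡ length rest → P (suc k) t ≡ t zero ! * t zero !
  P-closed t0≡L = begin
    P (suc k) t
      ≡⟨ count-≐ (isGD? (suc k) t) (arrangement? U? (blockWord (suc k) t))
                 ((λ (u , d) → u , All.universal _ _ , d) , (λ (u , _ , d) → u , d))
                 (words (allFin (size (suc k) t)) (size (suc k) t)) ⟩
    #arr U? (blockWord (suc k) t) (size (suc k) t)
      ≡⟨ cong (#arr U? (blockWord (suc k) t)) size≡ ⟩
    #arr U? (replicate (t zero) zero ++ rest) (t zero + length rest)
      ≡⟨ #arr-forced zero rest rest≢0 (t zero) U? (trans #colour-≢0 (sym t0≡L)) ⟩
    t zero ! * (count (ofColour? U? zero) (allFin (size (suc k) t)) P′ length rest)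
      ≡⟨ cong₂ (λ x y → t zero ! * (x P′ y)) #colour-0 (sym t0≡L) ⟩
    t zero ! * (t zero P′ t zero)
      ≡⟨ cong (t zero ! *_) (nP′n≡n! (t zero)) ⟩
    t zero ! * t zero ! ∎

  P'-closed : t zero ≡ length rest → sum (tabulate (t ∘ suc)) ≡ t zero
    → P' (suc k) t * prodFact (tabulate (t ∘ suc)) ≡ t zero !
  P'-closed t0≡L Σ≡t0 = begin
    P' (suc k) t * prodFact (tabulate (t ∘ suc))
      ≡⟨ cong (λ m → #rearr t (blockWord (suc k) t) m * prodFact (tabulate (t ∘ suc))) size≡ ⟩
    #rearr t (replicate (t zero) zero ++ rest) (t zero + length rest) * prodFact (tabulate (t ∘ suc))
      ≡⟨ #rearr-multinomial rest rest≢0 (t zero) t t0≡L Σ≡t0 ⟩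
    t zero ! ∎

corollary2p1 : (k : ℕ) → 1 ≤ k → (t : Fin (suc k) → ℕ)
    → t zero ≡ sum (tabulate (λ j → t (suc j)))
    → (P (suc k) t ≡ (sum (tabulate (λ j → t (suc j))) !) ^ 2
       × P (suc k) t ≡ (t zero !) ^ 2)
      × P' (suc k) t ≡ multinomial (t zero) (tabulate (λ j → t (suc j)))
corollary2p1 k _ t t0≡Σ = (trans P≡ (cong (λ x → (x !) ^ 2) t0≡Σ) , P≡) , P'≡
  where
  open BlockWord t

  t0≡L : t zero ≡ length rest
  t0≡L = trans t0≡Σ (sym length-rest)

  P≡ : P (suc k) t ≡ (t zero !) ^ 2
  P≡ = trans (P-closed t0≡L) (cong (t zero ! *_) (sym (*-identityʳ (t zero !))))

  ks : List ℕ
  ks = tabulate (t ∘ suc)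

  instance
    ks!≢0 : NonZero (prodFact ks)
    ks!≢0 = prodFact≢0 ks

  P'≡ : P' (suc k) t ≡ multinomial (t zero) ks
  P'≡ = trans (sym (m*n/n≡m (P' (suc k) t) (prodFact ks))) (cong (_/ prodFact ks) (P'-closed t0≡L (sym t0≡Σ)))
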